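{- Every matrix $M\in\mathbb{Z}^{m\times n}$ can be brought, using only negations of rows and negations of columns, to a matrix in which every nonzero row and every nonzero column begins with a negative entry.
   Context: A vector $v$ begins with a negative entry if for some $j$, $v_1=\dots=v_{j-1}=0$ and $v_j<0$. Negating a row (resp. column) means multiplying it by $-1$. -}

module Defs where

open import Data.Nat using (ℕ)
open import Data.Integer using (ℤ; -_; _<_; 0ℤ)
open import Data.Fin using (Fin; _<_)
open import Data.Bool using (Bool; true; false)
open import Data.Product using (Σ; ∃; _×_)
open import Relation.Binary.PropositionalEquality using (_≡_; _≢_)

Matrix : ℕ → ℕ → Set
Matrix m n = Fin m → Fin n → ℤ

flip? : Bool → ℤ → ℤ
flip? true  x = - x
flip? false x = x

-- Negate the rows i with r i = true and the columns j with c j = true.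
-- (Negations commute and are involutions, so every matrix obtainable by a
-- finite sequence of row/column negations is of this form, and conversely.)
negateRowsCols : ∀ {m n} → (Fin m → Bool) → (Fin n → Bool) → Matrix m n → Matrix m n
negateRowsCols r c M i j = flip? (r i) (flip? (c j) (M i j))

NonzeroVec : ∀ {k} → (Fin k → ℤ) → Set
NonzeroVec v = ∃ λ j → v j ≢ 0ℤ

BeginsNegative : ∀ {k} → (Fin k → ℤ) → Set
BeginsNegative {k} v = ∃ λ j → (∀ (i : Fin k) → i Data.Fin.< j → v i ≡ 0ℤ) × v j Data.Integer.< 0ℤ

row : ∀ {m n} → Matrix m n → Fin m → (Fin n → ℤ)
row M i = λ j → M i j

col : ∀ {m n} → Matrix m n → Fin n → (Fin m → ℤ)
col M j = λ i → M i j

{-# OPTIONS --safe #-}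
-- Induction on the number of rows, adding a last row to a normalised matrix.
-- A column that is nonzero above the new row keeps its leading entry, so its
-- old sign must stay; a column that is zero above it can be negated without
-- touching the old rows, and its leading entry (if any) lies in the new row.
-- So negate the new row to make its leading entry negative under the old
-- column signs, then negate each free column whose new entry is positive: if
-- the leading column of the new row is free, that entry becomes negative anyway.
module Submission where

open import Defs
open import Data.Nat using (ℕ; zero; suc; s≤s)
open import Data.Fin using (Fin; zero; suc; inject₁; fromℕ; punchIn)
import Data.Fin as Fin using (_<_)
open import Data.Fin.Properties using (toℕ-inject₁; ≤fromℕ; <-irrefl)
import Data.Nat as ℕ using (_<_)
import Data.Nat.Properties as ℕ using (<⇒≱)
open import Data.Vec.Functional using (init; last; insertAt)
open import Data.Vec.Functional.Properties using (insertAt-lookup; insertAt-punchIn)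
open import Data.Bool using (Bool; true; false)
open import Data.Product using (Σ; ∃; _×_; _,_; proj₁; proj₂)
open import Data.Sum using (_⊎_; inj₁; inj₂)
open import Data.Empty using (⊥-elim)
open import Data.Integer using (ℤ; +_; -[1+_]; -_; 0ℤ; -<+)
import Data.Integer as ℤ using (_<_; _≟_)
open import Data.Integer.Properties using (neg-involutive)
open import Function using (_∘_)
open import Relation.Nullary using (yes; no)
open import Relation.Binary.PropositionalEquality

flip?-0 : ∀ b → flip? b 0ℤ ≡ 0ℤ
flip?-0 true  = refl
flip?-0 false = refl

flip?-comm : ∀ a b x → flip? a (flip? b x) ≡ flip? b (flip? a x)
flip?-comm true  true  x = refl
flip?-comm true  false x = refl
flip?-comm false true  x = refl
flip?-comm false false x = refl

flip?≡0⇒≡0 : ∀ b {x} → flip? b x ≡ 0ℤ → x ≡ 0ℤ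
flip?≡0⇒≡0 true  {x} eq = trans (sym (neg-involutive x)) (cong -_ eq)
flip?≡0⇒≡0 false     eq = eq

flip?-≢0 : ∀ b {x} → x ≢ 0ℤ → flip? b x ≢ 0ℤ
flip?-≢0 b x≢0 = x≢0 ∘ flip?≡0⇒≡0 b

flip?-≢0⁻ : ∀ b {x} → flip? b x ≢ 0ℤ → x ≢ 0ℤ
flip?-≢0⁻ b fx≢0 x≡0 = fx≢0 (trans (cong (flip? b) x≡0) (flip?-0 b))

flip?²-0 : ∀ a b {x} → x ≡ 0ℤ → flip? a (flip? b x) ≡ 0ℤ
flip?²-0 a b refl = trans (cong (flip? a) (flip?-0 b)) (flip?-0 a)

flipToNegative : ℤ → Bool
flipToNegative (+ suc _) = true
flipToNegative _         = false

flip?-flipToNegative : ∀ x → x ≢ 0ℤ → flip? (flipToNegative x) x ℤ.< 0ℤ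
flip?-flipToNegative (+ zero)   x≢0 = ⊥-elim (x≢0 refl)
flip?-flipToNegative (+ suc _)  _   = -<+
flip?-flipToNegative -[1+ _ ]   _   = -<+

flipToNegative-under-flip? : ∀ a x → x ≢ 0ℤ →
  flip? a (flip? (flipToNegative (flip? a x)) x) ℤ.< 0ℤ
flipToNegative-under-flip? a x x≢0 = subst (ℤ._< 0ℤ) (flip?-comm (flipToNegative (flip? a x)) a x)
  (flip?-flipToNegative (flip? a x) (flip?-≢0 a x≢0))

ZeroBefore : ∀ {k} → (Fin k → ℤ) → Fin k → Set
ZeroBefore {k} v j = ∀ (i : Fin k) → i Fin.< j → v i ≡ 0ℤ

Leading : ∀ {k} → (Fin k → ℤ) → Set
Leading v = ∃ λ j → ZeroBefore v j × v j ≢ 0ℤ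

LeadsNegative : ∀ {k} → (Fin k → ℤ) → Set
LeadsNegative v = NonzeroVec v → BeginsNegative v

Normalised : ∀ {m n} → Matrix m n → Set
Normalised {m} {n} N =
  ((i : Fin m) → LeadsNegative (row N i)) × ((j : Fin n) → LeadsNegative (col N j))

allZero⊎leading : ∀ {k} (v : Fin k → ℤ) → (∀ j → v j ≡ 0ℤ) ⊎ Leading v
allZero⊎leading {zero}  v = inj₁ λ ()
allZero⊎leading {suc k} v with v zero ℤ.≟ 0ℤ | allZero⊎leading (v ∘ suc)
... | no v₀≢0  | _                       = inj₂ (zero , (λ _ ()) , v₀≢0)
... | yes v₀≡0 | inj₁ zeros              = inj₁ λ { zero → v₀≡0 ; (suc j) → zeros j }
... | yes v₀≡0 | inj₂ (j , before , v≢0) =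
  inj₂ (suc j , (λ { zero _ → v₀≡0 ; (suc i) (s≤s i<j) → before i i<j }) , v≢0)

nonzeroVec-cong : ∀ {k} {v w : Fin k → ℤ} → v ≗ w → NonzeroVec v → NonzeroVec w
nonzeroVec-cong v≗w (j , vj≢0) = j , vj≢0 ∘ trans (v≗w j)

beginsNegative-cong : ∀ {k} {v w : Fin k → ℤ} → v ≗ w → BeginsNegative v → BeginsNegative w
beginsNegative-cong v≗w (j , before , vj<0) =
  j , (λ i i<j → trans (sym (v≗w i)) (before i i<j)) , subst (ℤ._< 0ℤ) (v≗w j) vj<0

leadsNegative-cong : ∀ {k} {v w : Fin k → ℤ} → v ≗ w → LeadsNegative v → LeadsNegative w
leadsNegative-cong v≗w leads = beginsNegative-cong v≗w ∘ leads ∘ nonzeroVec-cong (sym ∘ v≗w)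

leadsNegative-zero : ∀ {k} {v : Fin k → ℤ} → (∀ j → v j ≡ 0ℤ) → LeadsNegative v
leadsNegative-zero zeros (j , vj≢0) = ⊥-elim (vj≢0 (zeros j))

inject₁-fromℕ-elim : ∀ {k} {P : Fin (suc k) → Set} →
  (∀ i → P (inject₁ i)) → P (fromℕ k) → ∀ i → P i
inject₁-fromℕ-elim {zero}  _     pLast zero    = pLast
inject₁-fromℕ-elim {suc k} pInit _     zero    = pInit zero
inject₁-fromℕ-elim {suc k} pInit pLast (suc i) = inject₁-fromℕ-elim (pInit ∘ suc) pLast i

zeroBefore-inject₁ : ∀ {k} {v : Fin (suc k) → ℤ} {j} →
  ZeroBefore (init v) j → ZeroBefore v (inject₁ j)
zeroBefore-inject₁ {j = j} before = inject₁-fromℕ-elim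
  (λ i i<j → before i (subst₂ ℕ._<_ (toℕ-inject₁ i) (toℕ-inject₁ j) i<j))
  (λ last<j → ⊥-elim (ℕ.<⇒≱ last<j (≤fromℕ (inject₁ j))))

zeroBefore-fromℕ : ∀ {k} {v : Fin (suc k) → ℤ} → (∀ i → init v i ≡ 0ℤ) → ZeroBefore v (fromℕ k)
zeroBefore-fromℕ zeros = inject₁-fromℕ-elim (λ i _ → zeros i) (⊥-elim ∘ <-irrefl refl)

last≢0 : ∀ {k} {v : Fin (suc k) → ℤ} → (∀ i → init v i ≡ 0ℤ) → NonzeroVec v → last v ≢ 0ℤ
last≢0 {v = v} zeros (j , vj≢0) = inject₁-fromℕ-elim {P = λ j → v j ≢ 0ℤ → last v ≢ 0ℤ}
  (λ i vi≢0 → ⊥-elim (vi≢0 (zeros i))) (λ last≢0 → last≢0) j vj≢0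

beginsNegative-init : ∀ {k} {v : Fin (suc k) → ℤ} → BeginsNegative (init v) → BeginsNegative v
beginsNegative-init (j , before , vj<0) = inject₁ j , zeroBefore-inject₁ before , vj<0

leadsNegative-last : ∀ {k} {v : Fin (suc k) → ℤ} →
  (∀ i → init v i ≡ 0ℤ) → (last v ≢ 0ℤ → last v ℤ.< 0ℤ) → LeadsNegative v
leadsNegative-last {k} zeros lastNegative nonzero =
  fromℕ k , zeroBefore-fromℕ zeros , lastNegative (last≢0 zeros nonzero)

insertAt-last : ∀ {k} {A : Set} (xs : Fin k → A) x → last (insertAt xs (fromℕ k) x) ≡ x
insertAt-last {k} xs = insertAt-lookup xs (fromℕ k)

punchIn-fromℕ : ∀ {k} (i : Fin k) → punchIn (fromℕ k) i ≡ inject₁ i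
punchIn-fromℕ zero    = refl
punchIn-fromℕ (suc i) = cong suc (punchIn-fromℕ i)

insertAt-init : ∀ {k} {A : Set} (xs : Fin k → A) x → init (insertAt xs (fromℕ k) x) ≗ xs
insertAt-init {k} xs x i = trans (cong (insertAt xs (fromℕ k) x) (sym (punchIn-fromℕ i)))
  (insertAt-punchIn xs (fromℕ k) x i)

module Extend {k n} (M : Matrix (suc k) n) (r′ : Fin k → Bool) (c′ : Fin n → Bool)
  (normal′ : Normalised (negateRowsCols r′ c′ (init M))) (ρ : Bool) where

  N′ : Matrix k n
  N′ = negateRowsCols r′ c′ (init M)

  colSign : ∀ j → (∀ i → init M i j ≡ 0ℤ) ⊎ Leading (col (init M) j) → Bool
  colSign j (inj₁ _) = flipToNegative (flip? ρ (last M j))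
  colSign j (inj₂ _) = c′ j

  r : Fin (suc k) → Bool
  r = insertAt r′ (fromℕ k) ρ

  c : Fin n → Bool
  c j = colSign j (allZero⊎leading (col (init M) j))

  N : Matrix (suc k) n
  N = negateRowsCols r c M

  signedCol : Fin n → Bool → Fin (suc k) → ℤ
  signedCol j b i = flip? (r i) (flip? b (M i j))

  init-signedCol : ∀ j z → init (signedCol j (colSign j z)) ≗ col N′ j
  init-signedCol j (inj₁ zeros) i = trans (flip?²-0 (r (inject₁ i)) (colSign j (inj₁ zeros)) (zeros i))
    (sym (flip?²-0 (r′ i) (c′ j) (zeros i)))
  init-signedCol j (inj₂ _) i = cong (λ b → flip? b (flip? (c′ j) (init M i j))) (insertAt-init r′ ρ i)

  row-inject₁ : ∀ i → row N (inject₁ i) ≗ row N′ i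
  row-inject₁ i j = init-signedCol j (allZero⊎leading (col (init M) j)) i

  last-signedCol : ∀ j b → last (signedCol j b) ≡ flip? ρ (flip? b (last M j))
  last-signedCol j b = cong (λ a → flip? a (flip? b (last M j))) (insertAt-last r′ ρ)

  row-fromℕ : row N (fromℕ k) ≗ λ j → flip? ρ (flip? (c j) (last M j))
  row-fromℕ j = last-signedCol j (c j)

  col-leads : ∀ j z → LeadsNegative (signedCol j (colSign j z))
  col-leads j (inj₁ zeros) = leadsNegative-last initZero lastNegative
    where
    b : Bool
    b = colSign j (inj₁ zeros)
    initZero : ∀ i → init (signedCol j b) i ≡ 0ℤ
    initZero i = trans (init-signedCol j (inj₁ zeros) i) (flip?²-0 (r′ i) (c′ j) (zeros i))
    lastNegative : last (signedCol j b) ≢ 0ℤ → last (signedCol j b) ℤ.< 0ℤ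
    lastNegative entry≢0 = subst (ℤ._< 0ℤ) (sym (last-signedCol j b))
      (flipToNegative-under-flip? ρ (last M j)
        (flip?-≢0⁻ b (flip?-≢0⁻ ρ (entry≢0 ∘ trans (last-signedCol j b)))))
  col-leads j z@(inj₂ (i , _ , Mij≢0)) _ =
    beginsNegative-init (beginsNegative-cong (sym ∘ init-signedCol j z)
      (proj₂ normal′ j (i , flip?-≢0 (r′ i) (flip?-≢0 (c′ j) Mij≢0))))

  lastRow-leads-zero : (∀ j → last M j ≡ 0ℤ) → LeadsNegative (row N (fromℕ k))
  lastRow-leads-zero zeros =
    leadsNegative-zero λ j → trans (row-fromℕ j) (flip?²-0 ρ (c j) (zeros j))

  lastRow-leads : ∀ j → ZeroBefore (last M) j → last M j ≢ 0ℤ →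
    flip? ρ (flip? (c′ j) (last M j)) ℤ.< 0ℤ → LeadsNegative (row N (fromℕ k))
  lastRow-leads j before Mj≢0 ρ-negates _ =
    j , (λ i i<j → trans (row-fromℕ i) (flip?²-0 ρ (c i) (before i i<j))) ,
    subst (ℤ._< 0ℤ) (sym (row-fromℕ j)) (negative (allZero⊎leading (col (init M) j)))
    where
    negative : ∀ z → flip? ρ (flip? (colSign j z) (last M j)) ℤ.< 0ℤ
    negative (inj₁ _) = flipToNegative-under-flip? ρ (last M j) Mj≢0
    negative (inj₂ _) = ρ-negates

  normalised : LeadsNegative (row N (fromℕ k)) → Normalised N
  normalised lastRowLeads =
    inject₁-fromℕ-elim (λ i → leadsNegative-cong (sym ∘ row-inject₁ i) (proj₁ normal′ i)) lastRowLeads ,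
    λ j → col-leads j (allZero⊎leading (col (init M) j))

extend : ∀ {k n} (M : Matrix (suc k) n) r′ c′ → Normalised (negateRowsCols r′ c′ (init M)) →
  Σ (Fin (suc k) → Bool) λ r → Σ (Fin n → Bool) λ c → Normalised (negateRowsCols r c M)
extend M r′ c′ normal′ with allZero⊎leading (last M)
... | inj₁ zeros = r , c , normalised (lastRow-leads-zero zeros)
  where open Extend M r′ c′ normal′ false
... | inj₂ (j , before , Mj≢0) = r , c , normalised (lastRow-leads j before Mj≢0 ρ-negates)
  where
  ρ-negates : flip? (flipToNegative (flip? (c′ j) (last M j))) (flip? (c′ j) (last M j)) ℤ.< 0ℤ
  ρ-negates = flip?-flipToNegative (flip? (c′ j) (last M j)) (flip?-≢0 (c′ j) Mj≢0)
  open Extend M r′ c′ normal′ (flipToNegative (flip? (c′ j) (last M j)))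

mainTheorem2 : (m n : ℕ) (M : Matrix m n) →
    Σ (Fin m → Bool) λ r → Σ (Fin n → Bool) λ c →
      ((i : Fin m) → NonzeroVec (row (negateRowsCols r c M) i) → BeginsNegative (row (negateRowsCols r c M) i))
      × ((j : Fin n) → NonzeroVec (col (negateRowsCols r c M) j) → BeginsNegative (col (negateRowsCols r c M) j))
mainTheorem2 zero    n M = (λ ()) , (λ _ → false) , (λ ()) , λ { _ (() , _) }
mainTheorem2 (suc m) n M with mainTheorem2 m n (init M)
... | r′ , c′ , normal′ = extend M r′ c′ normal′
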